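{- For every integer $n\ge15$, there exists a cubic totally silver graph of order $4n$ and girth $9$.
   Context: A totally silver coloring of a graph $G$ is a map $c$ from $V(G)$ to a set of colors such that for every $v\in V(G)$, each color appears exactly once on the closed neighborhood $N[v]$; a graph is totally silver if it admits one. Cubic means $3$--regular; girth is the length of a shortest cycle. -}

module Defs where

open import Data.Nat using (ℕ; zero; suc; _+_; _*_; _≤_; _<_)
open import Data.Fin using (Fin; toℕ; fromℕ<)
open import Data.Fin.Properties using ()
open import Data.Bool using (Bool; true; false; if_then_else_)
open import Data.List using (List; length; filter)
open import Data.List using () renaming (allFin to allFinL)
open import Data.Nat.Properties using (_≟_)
open import Data.Product using (Σ; ∃; _×_; _,_)
open import Relation.Binary.PropositionalEquality using (_≡_; _≢_)
open import Relation.Nullary using (¬_)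
open import Function.Definitions using (Injective)
import Data.Fin as F
import Data.Nat
import Relation.Nullary

record Graph (N : ℕ) : Set where
  field
    adj   : Fin N → Fin N → Bool
    sym   : ∀ u v → adj u v ≡ adj v u
    irrefl : ∀ v → adj v v ≡ false
open Graph public

Adj : ∀ {N} → Graph N → Fin N → Fin N → Set
Adj G u v = adj G u v ≡ true

degree : ∀ {N} → Graph N → Fin N → ℕ
degree {N} G v = length (filter (λ u → adj G v u Data.Bool.≟ true) (allFinL N))
  where import Data.Bool

Cubic : ∀ {N} → Graph N → Set
Cubic {N} G = ∀ (v : Fin N) → degree G v ≡ 3

InClosedNbhd : ∀ {N} → Graph N → Fin N → Fin N → Set
InClosedNbhd G v u = (u ≡ v) Data.Sum.⊎ Adj G v u
  where import Data.Sum

countInClosedNbhd : ∀ {N k} → Graph N → (Fin N → Fin k) → Fin k → Fin N → ℕ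
countInClosedNbhd {N} G c a v =
  length (filter (λ u → (c u F.≟ a) ×-dec ((u F.≟ v) ⊎-dec (adj G v u Data.Bool.≟ true)))
                 (allFinL N))
  where
    import Data.Bool
    open import Relation.Nullary.Decidable using (_×-dec_; _⊎-dec_)

TotallySilverColouring : ∀ {N} → Graph N → (k : ℕ) → (Fin N → Fin k) → Set
TotallySilverColouring {N} G k c = ∀ (v : Fin N) (a : Fin k) → countInClosedNbhd G c a v ≡ 1

TotallySilver : ∀ {N} → Graph N → Set
TotallySilver {N} G = Σ ℕ λ k → Σ (Fin N → Fin k) λ c → TotallySilverColouring G k c

next : ∀ {ℓ} → Fin ℓ → Fin ℓ
next {suc ℓ} i with toℕ i Data.Nat.<? ℓ
... | Relation.Nullary.yes p = F.suc (fromℕ< p)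
... | Relation.Nullary.no _  = F.zero

record Cycle {N} (G : Graph N) (ℓ : ℕ) : Set where
  field
    len≥3  : 3 ≤ ℓ
    vertex : Fin ℓ → Fin N
    inj    : Injective _≡_ _≡_ vertex
    edges  : ∀ (i : Fin ℓ) → Adj G (vertex i) (vertex (next i))

HasGirth : ∀ {N} → Graph N → ℕ → Set
HasGirth G g = Cycle G g × (∀ ℓ → ℓ < g → ¬ Cycle G ℓ)

-- Take the ℤₙ-lift of K₄ along antisymmetric voltages vol: vertex (i , x) is adjacent to
-- (j , x + vol i j) for every j ≢ i. Each vertex then has exactly one neighbour in every other
-- fibre, so the lift is cubic and colouring each vertex by its fibre is totally silver. A cycle of
-- length ℓ projects to a non-backtracking closed walk in K₄ whose net voltage is divisible by n. For
-- the voltages chosen below, a finite search shows that every such walk of length ℓ < 9 has net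
-- voltage of absolute value strictly between 0 and 15, so for n ≥ 15 there is no cycle shorter
-- than 9; a closed walk of length 9 with net voltage 0 lifts to a 9-cycle.
module Submission where

open import Defs
open import Data.Nat using (ℕ; _≤_; _*_)
open import Data.Product using (Σ; _×_)
open import Data.Nat as ℕ using (zero; suc; NonZero; _∸_)
import Data.Nat.Properties as ℕ
import Data.Nat.Divisibility as ℕ
open import Data.Nat.GeneralisedArithmetic using (iterate; iterate-is-fold)
open import Data.Integer as ℤ using (ℤ; +_; -_; _+_; _-_; ∣_∣)
import Data.Integer.Properties as ℤ
open import Data.Integer.Divisibility.Signed using (_∣_; _∣?_; divides; ∣⇒∣ᵤ; ∣m∣n⇒∣m+n; ∣m⇒∣-m)
open import Data.Integer.DivMod using (_%ℕ_; _/ℕ_; n%ℕd<d; a≡a%ℕn+[a/ℕn]*n)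
open import Data.Integer.Tactic.RingSolver using (solve-∀)
open import Data.Fin as Fin using (Fin; zero; suc; toℕ; fromℕ; fromℕ<; inject₁; _↑ˡ_; _↑ʳ_; combine; remQuot; quotient; _≟_)
open import Data.Fin.Patterns using (0F; 1F; 2F; 3F)
import Data.Fin.Properties as Fin
open import Data.Bool as Bool using (Bool; true; false; if_then_else_; not)
open import Data.List using (length; filter; tabulate)
open import Data.Vec.Functional using (Vector; _∷_; []; head; tail; init; last)
open import Data.Product using (_,_; proj₁; proj₂; map₂)
open import Data.Sum using (inj₁; inj₂)
open import Function using (_∘_; id; mk⇔)
open import Relation.Binary.PropositionalEquality hiding (sym; resp)
import Relation.Binary.PropositionalEquality as ≡
open import Relation.Binary.Definitions using (_Respects_)
open import Relation.Nullary using (Dec; yes; no; does; ¬_; ¬?; contradiction)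
open import Data.Empty using (⊥)
open import Relation.Nullary.Decidable using (toWitness; _×-dec_; _⊎-dec_; _→-dec_; map′; dec-true; dec-false; does-⇔)
open import Relation.Unary using (Pred; Decidable)
open import Algebra.Properties.Monoid.Sum ℕ.+-0-monoid using (sum; sum-cong-≗)
open import Algebra.Properties.Monoid.Sum ℤ.+-0-monoid using () renaming (sum to ∑ℤ; sum-cong-≗ to ∑ℤ-cong-≗)

sum-↑ : ∀ a b (f : Fin (a ℕ.+ b) → ℕ) → sum f ≡ sum {a} (f ∘ (_↑ˡ b)) ℕ.+ sum {b} (f ∘ (a ↑ʳ_))
sum-↑ zero    b f = refl
sum-↑ (suc a) b f = trans (cong (f zero ℕ.+_) (sum-↑ a b (f ∘ suc))) (≡.sym (ℕ.+-assoc (f zero) _ _))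

sum-combine : ∀ m n (f : Fin (m ℕ.* n) → ℕ) → sum f ≡ sum {m} (λ i → sum {n} (λ y → f (combine i y)))
sum-combine zero    n f = refl
sum-combine (suc m) n f =
  trans (sum-↑ n (m ℕ.* n) f) (cong (sum (λ y → f (y ↑ˡ (m ℕ.* n))) ℕ.+_) (sum-combine m n (f ∘ (n ↑ʳ_))))

indicator : Bool → ℕ
indicator b = if b then 1 else 0

count : ∀ {N} → (Fin N → Bool) → ℕ
count f = sum (indicator ∘ f)

count-combine : ∀ {m n} (f : Fin (m ℕ.* n) → Bool) → count f ≡ sum {m} (λ i → count {n} (f ∘ combine i))
count-combine {m} {n} f = sum-combine m n (indicator ∘ f)

count-none : ∀ {N p} {P : Pred (Fin N) p} (P? : Decidable P) → (∀ u → ¬ P u) → count (λ u → does (P? u)) ≡ 0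
count-none {zero}  P? ¬P = refl
count-none {suc N} P? ¬P rewrite dec-false (P? zero) (¬P zero) = count-none (P? ∘ suc) (¬P ∘ suc)

count-unique : ∀ {N p} {P : Pred (Fin N) p} (P? : Decidable P) (u₀ : Fin N) → P u₀ → (∀ u → P u → u ≡ u₀) →
               count (λ u → does (P? u)) ≡ 1
count-unique {suc N} P? zero P₀ unique rewrite dec-true (P? zero) P₀ =
  cong suc (count-none (P? ∘ suc) (λ u Pu → Fin.0≢1+n (≡.sym (unique (suc u) Pu))))
count-unique {suc N} P? (suc u₀) Pu₀ unique rewrite dec-false (P? zero) (λ P₀ → Fin.0≢1+n (unique zero P₀)) =
  count-unique (P? ∘ suc) u₀ Pu₀ (λ u Pu → Fin.suc-injective (unique (suc u) Pu))

count-≟ : ∀ {N} (a : Fin N) → count (λ u → does (a ≟ u)) ≡ 1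
count-≟ a = count-unique (a ≟_) a refl (λ _ → ≡.sym)

count-not : ∀ {N} (f : Fin N → Bool) → count f ℕ.+ count (not ∘ f) ≡ N
count-not {zero}  f = refl
count-not {suc N} f = step (f zero) (count-not (f ∘ suc))
  where
  step : ∀ b {x y} → x ℕ.+ y ≡ N → indicator b ℕ.+ x ℕ.+ (indicator (not b) ℕ.+ y) ≡ suc N
  step true          x+y≡N = cong suc x+y≡N
  step false {x} {y} x+y≡N = trans (ℕ.+-suc x y) (cong suc x+y≡N)

count-≢ : ∀ {N} (a : Fin N) → count (λ u → not (does (a ≟ u))) ≡ N ∸ 1
count-≢ {N} a = cong (_∸ 1) (begin
  1 ℕ.+ count (λ u → not (does (a ≟ u)))                            ≡⟨ cong (ℕ._+ count (λ u → not (does (a ≟ u)))) (count-≟ a) ⟨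
  count (λ u → does (a ≟ u)) ℕ.+ count (λ u → not (does (a ≟ u)))   ≡⟨ count-not (λ u → does (a ≟ u)) ⟩
  N                                                                  ∎)
  where open ≡-Reasoning

length-filter-tabulate : ∀ {a p} {A : Set a} {P : Pred A p} (P? : Decidable P) {N} (g : Fin N → A) →
                         length (filter P? (tabulate g)) ≡ count (λ u → does (P? (g u)))
length-filter-tabulate P? {zero}  g = refl
length-filter-tabulate P? {suc N} g with does (P? (g zero))
... | true  = cong suc (length-filter-tabulate P? (g ∘ suc))
... | false = length-filter-tabulate P? (g ∘ suc)

infix 4 _≡_[mod_] _≡?_[mod_]

record _≡_[mod_] (a b : ℤ) (n : ℕ) : Set where
  constructor congruent
  field multiple : + n ∣ a - b

_≡?_[mod_] : ∀ a b n → Dec (a ≡ b [mod n ])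
a ≡? b [mod n ] = map′ congruent _≡_[mod_].multiple (+ n ∣? a - b)

≡-mod-reflexive : ∀ {n a b} → a ≡ b → a ≡ b [mod n ]
≡-mod-reflexive {a = a} refl = congruent (divides (+ 0) (ℤ.+-inverseʳ a))

≡-mod-trans-sym : ∀ {n a b c} → a ≡ c [mod n ] → b ≡ c [mod n ] → a ≡ b [mod n ]
≡-mod-trans-sym {n} {a} {b} {c} (congruent n∣a-c) (congruent n∣b-c) =
  congruent (subst (+ n ∣_) (cancel a b c) (∣m∣n⇒∣m+n n∣a-c (∣m⇒∣-m n∣b-c)))
  where
  cancel : ∀ a b c → (a - c) + - (b - c) ≡ a - b
  cancel = solve-∀

≡-mod-+-trans : ∀ {n a b c s t} → a ≡ b + s [mod n ] → b ≡ c + t [mod n ] → a ≡ c + (t + s) [mod n ]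
≡-mod-+-trans {n} {a} {b} {c} {s} {t} (congruent n∣a-b-s) (congruent n∣b-c-t) =
  congruent (subst (+ n ∣_) (regroup a b c s t) (∣m∣n⇒∣m+n n∣a-b-s n∣b-c-t))
  where
  regroup : ∀ a b c s t → (a - (b + s)) + (b - (c + t)) ≡ a - (c + (t + s))
  regroup = solve-∀

≡-mod-+-cancelˡ : ∀ {n a s} → a ≡ a + s [mod n ] → + n ∣ s
≡-mod-+-cancelˡ {n} {a} {s} (congruent n∣a-a-s) = subst (+ n ∣_) (negate a s) (∣m⇒∣-m n∣a-a-s)
  where
  negate : ∀ a s → - (a - (a + s)) ≡ s
  negate = solve-∀

multiple-of-larger≡0 : ∀ {n s} → ∣ s ∣ ℕ.< n → + n ∣ s → s ≡ + 0
multiple-of-larger≡0 {n} {s} ∣s∣<n n∣s with ∣ s ∣ in ∣s∣≡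
... | zero  = ℤ.∣i∣≡0⇒i≡0 ∣s∣≡
... | suc _ = contradiction (subst (n ℕ.∣_) ∣s∣≡ (∣⇒∣ᵤ n∣s)) (ℕ.>⇒∤ ∣s∣<n)

residue-unique : ∀ {n y z} → y ℕ.< n → z ℕ.< n → + y ≡ + z [mod n ] → y ≡ z
residue-unique {n} {y} {z} y<n z<n (congruent n∣y-z) =
  ℤ.+-injective (ℤ.i-j≡0⇒i≡j (+ y) (+ z) (multiple-of-larger≡0 ∣y-z∣<n n∣y-z))
  where
  ∣y-z∣<n : ∣ + y - + z ∣ ℕ.< n
  ∣y-z∣<n = ℕ.≤-<-trans (ℕ.≤-reflexive (cong ∣_∣ (ℤ.m-n≡m⊖n y z)))
              (ℕ.≤-<-trans (ℤ.∣m⊝n∣≤m⊔n y z) (ℕ.⊔-lub y<n z<n))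

residue : ∀ n .{{_ : NonZero n}} → ℤ → Fin n
residue n t = fromℕ< (n%ℕd<d t n)

residue-≡ : ∀ n .{{_ : NonZero n}} t → + toℕ (residue n t) ≡ t [mod n ]
residue-≡ n t rewrite Fin.toℕ-fromℕ< (n%ℕd<d t n) = congruent (divides (- (t /ℕ n)) (begin
  + (t %ℕ n) - t                                 ≡⟨ cong (λ t′ → + (t %ℕ n) - t′) (a≡a%ℕn+[a/ℕn]*n t n) ⟩
  + (t %ℕ n) - (+ (t %ℕ n) + (t /ℕ n) ℤ.* + n)   ≡⟨ cancel (+ (t %ℕ n)) (t /ℕ n) (+ n) ⟩
  - (t /ℕ n) ℤ.* + n                             ∎))
  where
  open ≡-Reasoning
  cancel : ∀ r q m → r - (r + q ℤ.* m) ≡ - q ℤ.* m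
  cancel = solve-∀

iterate-next : ∀ {ℓ} (k : Fin ℓ) K → iterate next (next k) K ≡ next (iterate next k K)
iterate-next k K = trans (≡.sym (iterate-is-fold k next (suc K))) (cong next (iterate-is-fold k next K))

toℕ-next : ∀ {L} (i : Fin (suc L)) → toℕ i ℕ.< L → toℕ (next i) ≡ suc (toℕ i)
toℕ-next {L} i i<L with toℕ i ℕ.<? L
... | yes i<L′ = cong suc (Fin.toℕ-fromℕ< i<L′)
... | no  i≮L  = contradiction i<L i≮L

next-last : ∀ {L} (i : Fin (suc L)) → ¬ toℕ i ℕ.< L → next i ≡ zero
next-last {L} i i≮L with toℕ i ℕ.<? L
... | yes i<L = contradiction i<L i≮L
... | no  _   = refl

toℕ-iterate-next : ∀ {L} j → j ℕ.≤ L → toℕ (iterate next (zero {n = L}) j) ≡ j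
toℕ-iterate-next zero    _      = refl
toℕ-iterate-next (suc j) 1+j≤L = begin
  toℕ (iterate next zero (suc j))   ≡⟨ cong toℕ (iterate-next zero j) ⟩
  toℕ (next (iterate next zero j))  ≡⟨ toℕ-next _ (subst (ℕ._< _) (≡.sym ih) 1+j≤L) ⟩
  suc (toℕ (iterate next zero j))   ≡⟨ cong suc ih ⟩
  suc j                             ∎
  where
  open ≡-Reasoning
  ih = toℕ-iterate-next j (ℕ.<⇒≤ 1+j≤L)

iterate-next-period : ∀ L → iterate next (zero {n = L}) (suc L) ≡ zero
iterate-next-period L = trans (iterate-next zero L)
  (next-last _ (λ lt → ℕ.<-irrefl (toℕ-iterate-next L ℕ.≤-refl) lt))

next²≢id : ∀ {L} → 2 ℕ.≤ L → (i : Fin (suc L)) → next (next i) ≢ i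
next²≢id {L} 2≤L i next²i≡i = by-position (toℕ i ℕ.<? L)
  where
  open ≡-Reasoning
  toℕ-i≡toℕ-next² : toℕ i ≡ toℕ (next (next i))
  toℕ-i≡toℕ-next² = cong toℕ (≡.sym next²i≡i)
  by-position : Dec (toℕ i ℕ.< L) → ⊥
  by-position (no i≮L) = i≮L (subst (ℕ._< L) (begin
    1                    ≡⟨ toℕ-next zero (ℕ.<-≤-trans (ℕ.s≤s ℕ.z≤n) 2≤L) ⟨
    toℕ (next zero)      ≡⟨ cong (toℕ ∘ next) (next-last i i≮L) ⟨
    toℕ (next (next i))  ≡⟨ toℕ-i≡toℕ-next² ⟨
    toℕ i                ∎) 2≤L)
  by-position (yes i<L) with suc (toℕ i) ℕ.<? L
  ... | yes 1+i<L = ℕ.m≢1+n+m (toℕ i) (begin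
    toℕ i                ≡⟨ toℕ-i≡toℕ-next² ⟩
    toℕ (next (next i))  ≡⟨ toℕ-next (next i) (subst (ℕ._< L) (≡.sym (toℕ-next i i<L)) 1+i<L) ⟩
    suc (toℕ (next i))   ≡⟨ cong suc (toℕ-next i i<L) ⟩
    suc (suc (toℕ i))    ∎)
  ... | no 1+i≮L = 1+i≮L (subst (λ t → suc t ℕ.< L) (begin
    0                    ≡⟨ cong toℕ (next-last (next i) (subst (λ t → ¬ t ℕ.< L) (≡.sym (toℕ-next i i<L)) 1+i≮L)) ⟨
    toℕ (next (next i))  ≡⟨ toℕ-i≡toℕ-next² ⟨
    toℕ i                ∎) 2≤L)

-- Non-backtracking closed walks and their net voltage

module _ {A : Set} where

  NonBacktracking : ∀ {ℓ} → (Fin ℓ → A) → Set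
  NonBacktracking c = ∀ k → c k ≢ c (next k) × c k ≢ c (next (next k))

  walk : ∀ {ℓ} → (Fin ℓ → A) → Fin ℓ → ∀ K → Vector A K
  walk c k K i = c (iterate next k (toℕ i))

  NonBacktrackingPath : ∀ {K} → Vector A (2 ℕ.+ K) → Set
  NonBacktrackingPath {zero}  b = b 0F ≢ b 1F
  NonBacktrackingPath {suc K} b = b 0F ≢ b 1F × b 0F ≢ b 2F × NonBacktrackingPath (tail b)

  walk-nonBacktracking : ∀ {ℓ} {c : Fin ℓ → A} → NonBacktracking c → ∀ K k → NonBacktrackingPath (walk c k (2 ℕ.+ K))
  walk-nonBacktracking nb zero    k = proj₁ (nb k)
  walk-nonBacktracking nb (suc K) k = proj₁ (nb k) , proj₂ (nb k) , walk-nonBacktracking nb K (next k)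

  -- A closed walk c₀ … c₍ℓ₋₁₎ is encoded unrolled two steps past its start, as c₀ … c₍ℓ₋₁₎ c₀ c₁,
  -- so that NonBacktrackingPath also constrains the turns at the closing point.
  Wraps : ∀ {K} → Vector A (2 ℕ.+ K) → Set
  Wraps b = last (init b) ≡ head b × last b ≡ head (tail b)

  netVoltage : (A → A → ℤ) → ∀ {K} → Vector A (suc K) → ℤ
  netVoltage vol {K} b = ∑ℤ {K} (λ i → vol (b (inject₁ i)) (b (suc i)))

  netVoltage-cong : ∀ vol {K} {b b′ : Vector A (suc K)} → b ≗ b′ → netVoltage vol b ≡ netVoltage vol b′
  netVoltage-cong vol b≗b′ = ∑ℤ-cong-≗ (λ i → cong₂ vol (b≗b′ (inject₁ i)) (b≗b′ (suc i)))

-- Extending paths one vertex at a time discards backtracking prefixes early; enumerating all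
-- vectors and filtering afterwards is far too slow for the walk lengths needed below.
∀-nonBacktrackingPath? : ∀ {m} K {q} {Q : Pred (Vector (Fin m) (2 ℕ.+ K)) q} → Q Respects _≗_ → Decidable Q →
                         Dec (∀ b → NonBacktrackingPath b → Q b)
∀-nonBacktrackingPath? zero resp Q? =
  map′ (λ h b b₀≢b₁ → resp (λ { 0F → refl ; 1F → refl }) (h (b 0F) (b 1F) b₀≢b₁))
       (λ h x y x≢y → h (x ∷ y ∷ []) x≢y)
       (Fin.all? λ x → Fin.all? λ y → ¬? (x ≟ y) →-dec Q? (x ∷ y ∷ []))
∀-nonBacktrackingPath? (suc K) {Q = Q} resp Q? =
  map′ (λ h b (b₀≢b₁ , b₀≢b₂ , p) → resp (λ { 0F → refl ; (suc i) → refl }) (h (tail b) p (head b) b₀≢b₁ b₀≢b₂))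
       (λ h t p x x≢t₀ x≢t₁ → h (x ∷ t) (x≢t₀ , x≢t₁ , p))
       (∀-nonBacktrackingPath? K respˢ λ t → Fin.all? λ x → ¬? (x ≟ t 0F) →-dec ¬? (x ≟ t 1F) →-dec Q? (x ∷ t))
  where
  respˢ : (λ t → ∀ x → x ≢ t 0F → x ≢ t 1F → Q (x ∷ t)) Respects _≗_
  respˢ t≗t′ h x x≢t₀ x≢t₁ =
    resp (λ { 0F → refl ; (suc i) → t≗t′ i })
         (h x (λ e → x≢t₀ (trans e (t≗t′ 0F))) (λ e → x≢t₁ (trans e (t≗t′ 1F))))

NonzeroBelow : ℕ → ℤ → Set
NonzeroBelow B s = s ≢ + 0 × ∣ s ∣ ℕ.< B

nonzeroBelow? : ∀ B s → Dec (NonzeroBelow B s)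
nonzeroBelow? B s = ¬? (s ℤ.≟ + 0) ×-dec (∣ s ∣ ℕ.<? B)

nonzeroBelow-∤ : ∀ {n s} → NonzeroBelow n s → ¬ (+ n ∣ s)
nonzeroBelow-∤ (s≢0 , ∣s∣<n) n∣s = s≢0 (multiple-of-larger≡0 ∣s∣<n n∣s)

ClosedWalksNonzeroBelow : ∀ {m} → (Fin m → Fin m → ℤ) → ℕ → ℕ → Set
ClosedWalksNonzeroBelow {m} vol B ℓ =
  ∀ (b : Vector (Fin m) (2 ℕ.+ ℓ)) → NonBacktrackingPath b → Wraps b → NonzeroBelow B (netVoltage vol (init b))

closedWalksNonzeroBelow? : ∀ {m} vol B ℓ → Dec (ClosedWalksNonzeroBelow {m} vol B ℓ)
closedWalksNonzeroBelow? vol B ℓ = ∀-nonBacktrackingPath? ℓ resp (λ b → wraps? b →-dec nonzeroBelow? B _)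
  where
  wraps? : ∀ b → Dec (Wraps b)
  wraps? b = (last (init b) ≟ head b) ×-dec (last b ≟ head (tail b))
  resp : (λ b → Wraps b → NonzeroBelow B (netVoltage vol (init b))) Respects _≗_
  resp b≗b′ bounded (w₁ , w₂) =
    subst (NonzeroBelow B) (netVoltage-cong vol (b≗b′ ∘ inject₁))
      (bounded (trans (b≗b′ _) (trans w₁ (≡.sym (b≗b′ _))) , trans (b≗b′ _) (trans w₂ (≡.sym (b≗b′ _)))))

closedWalksNonzeroBelow-mono : ∀ {m} vol {B B′ ℓ} → B ℕ.≤ B′ → ClosedWalksNonzeroBelow {m} vol B ℓ → ClosedWalksNonzeroBelow vol B′ ℓ
closedWalksNonzeroBelow-mono vol B≤B′ bounded b p w = map₂ (λ ∣s∣<B → ℕ.<-≤-trans ∣s∣<B B≤B′) (bounded b p w)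

-- Lifts of complete graphs along voltages

from-does : ∀ {p} {P : Set p} (P? : Dec P) → does P? ≡ true → P
from-does (yes p) _ = p

-- The vertex (i , x) of the lift, with i a vertex of Kₘ and x ∈ ℤ/n, is combine i x : Fin (m * n).
module VoltageLift {m n : ℕ} .{{_ : NonZero n}} (vol : Fin m → Fin m → ℤ) (vol-antisym : ∀ i j → vol j i ≡ - vol i j) where

  Step : Fin m × Fin n → Fin m × Fin n → Set
  Step (i , x) (j , y) = i ≢ j × + toℕ y ≡ + toℕ x + vol i j [mod n ]

  step? : ∀ p q → Dec (Step p q)
  step? (i , x) (j , y) = ¬? (i ≟ j) ×-dec (+ toℕ y ≡? + toℕ x + vol i j [mod n ])

  Step-sym : ∀ {p q} → Step p q → Step q p
  Step-sym {i , x} {j , y} (i≢j , congruent n∣y-x-v) = i≢j ∘ ≡.sym , congruent (subst (+ n ∣_) reverse (∣m⇒∣-m n∣y-x-v))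
    where
    negate : ∀ x y v → - (y - (x + v)) ≡ x - (y + - v)
    negate = solve-∀
    reverse : - (+ toℕ y - (+ toℕ x + vol i j)) ≡ + toℕ x - (+ toℕ y + vol j i)
    reverse rewrite vol-antisym i j = negate (+ toℕ x) (+ toℕ y) (vol i j)

  Step-functional : ∀ {p j y z} → Step p (j , y) → Step p (j , z) → y ≡ z
  Step-functional (_ , y≡t) (_ , z≡t) =
    Fin.toℕ-injective (residue-unique (Fin.toℕ<n _) (Fin.toℕ<n _) (≡-mod-trans-sym y≡t z≡t))

  target : Fin m → Fin n → Fin m → Fin n
  target i x j = residue n (+ toℕ x + vol i j)

  Step-target : ∀ {i j} x → i ≢ j → Step (i , x) (j , target i x j)
  Step-target x i≢j = i≢j , residue-≡ n _

  lift : Graph (m ℕ.* n)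
  adj    lift u v = does (step? (remQuot n u) (remQuot n v))
  sym    lift u v = does-⇔ (mk⇔ Step-sym Step-sym) (step? (remQuot n u) (remQuot n v)) (step? (remQuot n v) (remQuot n u))
  irrefl lift v   = dec-false (step? _ _) (λ (i≢i , _) → i≢i refl)

  Adj⇒Step : ∀ {i x j y} → Adj lift (combine i x) (combine j y) → Step (i , x) (j , y)
  Adj⇒Step {i} {x} {j} {y} adj =
    subst₂ Step (Fin.remQuot-combine i x) (Fin.remQuot-combine j y) (from-does (step? _ _) adj)

  Step⇒Adj : ∀ {i x j y} → Step (i , x) (j , y) → Adj lift (combine i x) (combine j y)
  Step⇒Adj {i} {x} {j} {y} step =
    dec-true (step? _ _) (subst₂ Step (≡.sym (Fin.remQuot-combine i x)) (≡.sym (Fin.remQuot-combine j y)) step)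

  fibre : Fin (m ℕ.* n) → Fin m
  fibre = quotient n

  fibre-combine : ∀ i x → fibre (combine i x) ≡ i
  fibre-combine i x = cong proj₁ (Fin.remQuot-combine i x)

  adj? : ∀ u v → Dec (Adj lift u v)
  adj? u v = adj lift u v Bool.≟ true

  count-neighbours-in-fibre : ∀ i x j → count {n} (λ y → does (adj? (combine i x) (combine j y))) ≡ indicator (not (does (i ≟ j)))
  count-neighbours-in-fibre i x j with i ≟ j
  ... | yes refl = count-none (λ y → adj? (combine i x) (combine i y)) (λ y adj → proj₁ (Adj⇒Step adj) refl)
  ... | no i≢j   = count-unique (λ y → adj? (combine i x) (combine j y)) (target i x j) (Step⇒Adj (Step-target x i≢j))
                     (λ y adj → Step-functional (Adj⇒Step adj) (Step-target x i≢j))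

  regular : ∀ v → degree lift v ≡ m ∸ 1
  regular v with i , x , refl ← Fin.combine-surjective {m} {n} v = begin
    degree lift (combine i x)                                                  ≡⟨ length-filter-tabulate (adj? (combine i x)) id ⟩
    count (λ u → does (adj? (combine i x) u))                                  ≡⟨ count-combine {m} {n} _ ⟩
    sum {m} (λ j → count {n} (λ y → does (adj? (combine i x) (combine j y))))  ≡⟨ sum-cong-≗ (count-neighbours-in-fibre i x) ⟩
    count (λ j → not (does (i ≟ j)))                                           ≡⟨ count-≢ i ⟩
    m ∸ 1                                                                      ∎
    where open ≡-Reasoning

  inClosedNbhd? : ∀ a v u → Dec (fibre u ≡ a × InClosedNbhd lift v u)
  inClosedNbhd? a v u = (fibre u ≟ a) ×-dec ((u ≟ v) ⊎-dec adj? v u)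

  count-closedNbhd-in-fibre : ∀ i x a j → count {n} (λ y → does (inClosedNbhd? a (combine i x) (combine j y))) ≡ indicator (does (a ≟ j))
  count-closedNbhd-in-fibre i x a j with a ≟ j
  ... | no a≢j = count-none (λ y → inClosedNbhd? a (combine i x) (combine j y))
                   (λ y (fibre≡a , _) → a≢j (trans (≡.sym fibre≡a) (fibre-combine j y)))
  ... | yes refl with i ≟ a
  ...   | yes refl = count-unique (λ y → inClosedNbhd? i (combine i x) (combine i y)) x (fibre-combine i x , inj₁ refl)
                       λ { y (_ , inj₁ same) → Fin.combine-injectiveʳ i y i x same
                         ; y (_ , inj₂ adj)  → contradiction refl (proj₁ (Adj⇒Step adj)) }
  ...   | no i≢a   = count-unique (λ y → inClosedNbhd? a (combine i x) (combine a y)) (target i x a)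
                       (fibre-combine a _ , inj₂ (Step⇒Adj (Step-target x i≢a)))
                       λ { y (_ , inj₁ same) → contradiction (Fin.combine-injectiveˡ a y i x same) (i≢a ∘ ≡.sym)
                         ; y (_ , inj₂ adj)  → Step-functional (Adj⇒Step adj) (Step-target x i≢a) }

  totallySilver : TotallySilverColouring lift m fibre
  totallySilver v a with i , x , refl ← Fin.combine-surjective {m} {n} v = begin
    countInClosedNbhd lift fibre a (combine i x)                                           ≡⟨ length-filter-tabulate (inClosedNbhd? a (combine i x)) id ⟩
    count (λ u → does (inClosedNbhd? a (combine i x) u))                                   ≡⟨ count-combine {m} {n} _ ⟩
    sum {m} (λ j → count {n} (λ y → does (inClosedNbhd? a (combine i x) (combine j y))))  ≡⟨ sum-cong-≗ (count-closedNbhd-in-fibre i x a) ⟩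
    count (λ j → does (a ≟ j))                                                             ≡⟨ count-≟ a ⟩
    1                                                                                      ∎
    where open ≡-Reasoning

  module _ {ℓ} (C : Cycle lift ℓ) where
    open Cycle C

    colour : Fin ℓ → Fin m
    colour = fibre ∘ vertex

    level : Fin ℓ → Fin n
    level = proj₂ ∘ remQuot {m} n ∘ vertex

    cycle-step : ∀ k → Step (colour k , level k) (colour (next k) , level (next k))
    cycle-step k = from-does (step? _ _) (edges k)

    vertex-≡ : ∀ {k k′} → colour k ≡ colour k′ → level k ≡ level k′ → vertex k ≡ vertex k′
    vertex-≡ {k} {k′} colour≡ level≡ = begin
      vertex k                       ≡⟨ Fin.combine-remQuot {m} n (vertex k) ⟨
      combine (colour k) (level k)   ≡⟨ cong₂ combine colour≡ level≡ ⟩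
      combine (colour k′) (level k′) ≡⟨ Fin.combine-remQuot {m} n (vertex k′) ⟩
      vertex k′                      ∎
      where open ≡-Reasoning

    -- vertex k and vertex (next (next k)) are neighbours of vertex (next k), which has one neighbour per fibre.
    cycle-nonBacktracking : (∀ k → next (next k) ≢ k) → NonBacktracking colour
    cycle-nonBacktracking next²≢id k = proj₁ (cycle-step k) , λ colour≡ →
      next²≢id k (≡.sym (inj (vertex-≡ colour≡ (Step-functional (Step-sym (cycle-step k))
        (subst (λ j → Step (colour (next k) , level (next k)) (j , level (next (next k)))) (≡.sym colour≡) (cycle-step (next k)))))))

    cycle-level : ∀ K k → + toℕ (level (iterate next k K)) ≡ + toℕ (level k) + netVoltage vol (walk colour k (suc K)) [mod n ]
    cycle-level zero    k = ≡-mod-reflexive (≡.sym (ℤ.+-identityʳ _))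
    cycle-level (suc K) k =
      ≡-mod-+-trans {c = + toℕ (level k)} {s = netVoltage vol (walk colour (next k) (suc K))} {t = vol (colour k) (colour (next k))}
        (cycle-level K (next k)) (proj₂ (cycle-step k))

    module _ (k : Fin ℓ) (period : iterate next k ℓ ≡ k) where

      unrolled : Vector (Fin m) (2 ℕ.+ ℓ)
      unrolled = walk colour k (2 ℕ.+ ℓ)

      unrolled-wraps : Wraps unrolled
      unrolled-wraps =
          trans (cong (colour ∘ iterate next k) (trans (Fin.toℕ-inject₁ (fromℕ ℓ)) (Fin.toℕ-fromℕ ℓ))) (cong colour period)
        , trans (cong (colour ∘ iterate next (next k)) (Fin.toℕ-fromℕ ℓ)) (cong colour (trans (iterate-next k ℓ) (cong next period)))

      closedWalk-divisible : + n ∣ netVoltage vol (walk colour k (suc ℓ))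
      closedWalk-divisible = ≡-mod-+-cancelˡ
        (subst (λ k′ → + toℕ (level k′) ≡ + toℕ (level k) + netVoltage vol (walk colour k (suc ℓ)) [mod n ]) period (cycle-level ℓ k))

      init-unrolled : init unrolled ≗ walk colour k (suc ℓ)
      init-unrolled i = cong (colour ∘ iterate next k) (Fin.toℕ-inject₁ i)

      unrolled-divisible : + n ∣ netVoltage vol (init unrolled)
      unrolled-divisible = subst (+ n ∣_) (netVoltage-cong vol (≡.sym ∘ init-unrolled)) closedWalk-divisible

  no-cycle : ∀ {ℓ} → 3 ℕ.≤ ℓ → ClosedWalksNonzeroBelow vol n ℓ → ¬ Cycle lift ℓ
  no-cycle {suc L} (ℕ.s≤s 2≤L) bounded C = nonzeroBelow-∤
    (bounded (unrolled C zero period) (walk-nonBacktracking (cycle-nonBacktracking C (next²≢id 2≤L)) (suc L) zero)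
             (unrolled-wraps C zero period))
    (unrolled-divisible C zero period)
    where
    period : iterate next zero (suc L) ≡ zero
    period = iterate-next-period L

-- The lift of K₄

voltage : Fin 4 → Fin 4 → ℤ
voltage 1F 2F = + 1
voltage 2F 1F = - + 1
voltage 2F 3F = + 2
voltage 3F 2F = - + 2
voltage 3F 1F = + 4
voltage 1F 3F = - + 4
voltage _  _  = + 0

voltage-antisym : ∀ i j → voltage j i ≡ - voltage i j
voltage-antisym = toWitness {a? = Fin.all? λ i → Fin.all? λ j → voltage j i ℤ.≟ - voltage i j} _

-- Opaque, since unfolding it would make the type checker replay the search.
opaque
  shortClosedWalks : ∀ (ℓ : Fin 9) → 3 ℕ.≤ toℕ ℓ → ClosedWalksNonzeroBelow voltage 15 (toℕ ℓ)
  shortClosedWalks = toWitness {a? = Fin.all? λ ℓ → (3 ℕ.≤? toℕ ℓ) →-dec closedWalksNonzeroBelow? voltage 15 (toℕ ℓ)} _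

nineCycleColour : Vector (Fin 4) 9
nineCycleColour = 0F ∷ 1F ∷ 2F ∷ 0F ∷ 1F ∷ 2F ∷ 0F ∷ 3F ∷ 2F ∷ []

nineCycleLevel : Vector ℕ 9
nineCycleLevel = 0 ∷ 0 ∷ 1 ∷ 1 ∷ 1 ∷ 2 ∷ 2 ∷ 2 ∷ 0 ∷ []

nineCycle-steps : ∀ k → nineCycleColour k ≢ nineCycleColour (next k) ×
                        + nineCycleLevel (next k) ≡ + nineCycleLevel k + voltage (nineCycleColour k) (nineCycleColour (next k))
nineCycle-steps = toWitness {a? = Fin.all? λ k → ¬? (nineCycleColour k ≟ nineCycleColour (next k)) ×-dec
  (+ nineCycleLevel (next k) ℤ.≟ + nineCycleLevel k + voltage (nineCycleColour k) (nineCycleColour (next k)))} _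

nineCycle-distinct : ∀ k k′ → nineCycleColour k ≡ nineCycleColour k′ → nineCycleLevel k ≡ nineCycleLevel k′ → k ≡ k′
nineCycle-distinct = toWitness {a? = Fin.all? λ k → Fin.all? λ k′ →
  (nineCycleColour k ≟ nineCycleColour k′) →-dec (nineCycleLevel k ℕ.≟ nineCycleLevel k′) →-dec (k ≟ k′)} _

nineCycleLevel<15 : ∀ k → nineCycleLevel k ℕ.< 15
nineCycleLevel<15 = toWitness {a? = Fin.all? λ k → nineCycleLevel k ℕ.<? 15} _

module K₄Lift (n : ℕ) (15≤n : 15 ℕ.≤ n) where

  private instance
    n≢0 : NonZero n
    n≢0 = ℕ.>-nonZero (ℕ.<-≤-trans (ℕ.s≤s ℕ.z≤n) 15≤n)

  open VoltageLift {4} {n} voltage voltage-antisym public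

  nineCycle : Cycle lift 9
  nineCycle = record { len≥3 = ℕ.s≤s (ℕ.s≤s (ℕ.s≤s ℕ.z≤n)) ; vertex = vertex ; inj = injective ; edges = edges }
    where
    finLevel : Fin 9 → Fin n
    finLevel k = fromℕ< (ℕ.<-≤-trans (nineCycleLevel<15 k) 15≤n)
    toℕ-finLevel : ∀ k → toℕ (finLevel k) ≡ nineCycleLevel k
    toℕ-finLevel k = Fin.toℕ-fromℕ< (ℕ.<-≤-trans (nineCycleLevel<15 k) 15≤n)
    vertex : Fin 9 → Fin (4 * n)
    vertex k = combine (nineCycleColour k) (finLevel k)
    injective : ∀ {k k′} → vertex k ≡ vertex k′ → k ≡ k′
    injective {k} {k′} same with colour≡ , finLevel≡ ← Fin.combine-injective _ _ _ _ same =
      nineCycle-distinct k k′ colour≡ (trans (≡.sym (toℕ-finLevel k)) (trans (cong toℕ finLevel≡) (toℕ-finLevel k′)))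
    edges : ∀ k → Adj lift (vertex k) (vertex (next k))
    edges k with colour≢ , level≡ ← nineCycle-steps k = Step⇒Adj (colour≢ , ≡-mod-reflexive
      (subst₂ (λ y x → + y ≡ + x + voltage (nineCycleColour k) (nineCycleColour (next k)))
              (≡.sym (toℕ-finLevel (next k))) (≡.sym (toℕ-finLevel k)) level≡))

  noShortCycle : ∀ ℓ → ℓ ℕ.< 9 → ¬ Cycle lift ℓ
  noShortCycle ℓ ℓ<9 C = no-cycle 3≤ℓ (closedWalksNonzeroBelow-mono voltage 15≤n bounded) C
    where
    3≤ℓ : 3 ℕ.≤ ℓ
    3≤ℓ = Cycle.len≥3 C
    bounded : ClosedWalksNonzeroBelow voltage 15 ℓ
    bounded = subst (ClosedWalksNonzeroBelow voltage 15) (Fin.toℕ-fromℕ< ℓ<9)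
                (shortClosedWalks (fromℕ< ℓ<9) (subst (3 ℕ.≤_) (≡.sym (Fin.toℕ-fromℕ< ℓ<9)) 3≤ℓ))

theorem5p1 : ∀ (n : ℕ) → 15 ≤ n →
    Σ (Graph (4 * n)) λ G → Cubic G × TotallySilver G × HasGirth G 9
theorem5p1 n 15≤n = lift , regular , (4 , fibre , totallySilver) , nineCycle , noShortCycle
  where open K₄Lift n 15≤n
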